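{- Let $b\ge 2$ and $k\ge 1$ be integers. Let $d_1,d_2,\dots$ be independent digits uniform on $\{0,\dots,b-1\}$ (the base-$b$ digits of a random number, $d_1$ rightmost), and define the carries for multiplication by $k$ by $\kappa_0=0$ and $\kappa_t=\lfloor(\kappa_{t-1}+k\,d_t)/b\rfloor$; this is a Markov chain on $\{0,\dots,k-1\}$. Let $K_0^r$ denote the distribution of $\kappa_r$ and $\pi$ the uniform distribution on $\{0,1,\dots,k-1\}$. Then for all $r\ge 0$, $$\frac12\sum_{j=0}^{k-1}\left|K_0^r(j)-\pi(j)\right|\le \frac{k}{2b^r}.$$ -}

module Defs where

open import Data.Nat as ℕ using (ℕ; zero; suc; _+_; _*_; _^_; _≤_; z≤n; s≤s; NonZero; >-nonZero)
open import Data.Nat.Properties using (≤-trans; m^n≢0)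
open import Data.Nat.DivMod using (_/_)
open import Data.Fin using (Fin; toℕ)
open import Data.Vec using (Vec; []; _∷_)
open import Data.List as List using (List; []; _∷_; concatMap; map; filter; length; upTo; allFin)
open import Data.Integer using (+_)
open import Data.Rational as ℚ using (ℚ)

nz₂ : ∀ {b} → 2 ≤ b → NonZero b
nz₂ hb = >-nonZero (≤-trans (s≤s z≤n) hb)

nz₁ : ∀ {k} → 1 ≤ k → NonZero k
nz₁ hk = >-nonZero hk

-- All digit strings (d₁, …, d_r) ∈ {0,…,b-1}^r ; head of the vector is d₁ (rightmost digit)
allDigits : (b r : ℕ) → List (Vec (Fin b) r)
allDigits b zero    = [] ∷ []
allDigits b (suc r) = concatMap (λ d → map (d ∷_) (allDigits b r)) (allFin b)

carryFrom : ∀ {b r} (hb : 2 ≤ b) (k : ℕ) → ℕ → Vec (Fin b) r → ℕ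
carryFrom hb k κ []       = κ
carryFrom {b} hb k κ (d ∷ ds) =
  carryFrom hb k (_/_ (κ + k * toℕ d) b {{nz₂ hb}}) ds

carry : ∀ {b r} (hb : 2 ≤ b) (k : ℕ) → Vec (Fin b) r → ℕ
carry hb k ds = carryFrom hb k 0 ds

K₀ : ∀ {b} (hb : 2 ≤ b) (k r j : ℕ) → ℚ
K₀ {b} hb k r j =
  ℚ._/_ (+ length (filter (λ ds → carry hb k ds ℕ.≟ j) (allDigits b r)))
        (b ^ r) {{m^n≢0 b r {{nz₂ hb}}}}

π : ∀ {k} (hk : 1 ≤ k) (j : ℕ) → ℚ
π {k} hk j = ℚ._/_ (+ 1) k {{nz₁ hk}}

sumℚ : List ℚ → ℚ
sumℚ = List.foldr ℚ._+_ ℚ.0ℚ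

tvDist : ∀ {b k} (hb : 2 ≤ b) (hk : 1 ≤ k) (r : ℕ) → ℚ
tvDist {b} {k} hb hk r =
  ℚ.½ ℚ.* sumℚ (map (λ j → ℚ.∣ K₀ hb k r j ℚ.- π hk j ∣) (upTo k))

bound : ∀ {b} (hb : 2 ≤ b) (k r : ℕ) → ℚ
bound {b} hb k r =
  ℚ.½ ℚ.* ℚ._/_ (+ k) (b ^ r) {{m^n≢0 b r {{nz₂ hb}}}}

-- The carry after r digits is ⌊k N / b^r⌋, where N is the number written by the digits, and as the
-- digit strings range over {0,…,b-1}^r, N runs exactly once through [0, B) with B = b^r.  So B K₀ʳ(j)
-- counts the N < B with j B ≤ k N < (j+1) B.  The number of multiples of k below x is ⌈x/k⌉, which is
-- within 1 of x/k; taking the difference at x = (j+1) B and at x = j B shows that k B K₀ʳ(j) is within k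
-- of B.  Hence |K₀ʳ(j) − 1/k| ≤ 1/B for each of the k values of j, and summing gives the bound.
module Submission where

open import Algebra.Properties.CommutativeSemigroup using (interchange)
open import Data.Bool using (true; false; if_then_else_)
open import Data.Fin using (Fin; toℕ)
open import Data.Integer as ℤ using (ℤ; _⊖_)
import Data.Integer.Properties as ℤP
open import Data.Integer.Tactic.RingSolver renaming (solve-∀ to ℤ-solve-∀)
open import Data.List using (List; []; _∷_; _++_; concatMap; map; filter; length; upTo; allFin; tabulate)
open import Data.List.Membership.Propositional.Properties using (∈-upTo⁻)
open import Data.List.Properties using (map-++; map-cong; map-∘; map-tabulate; length-upTo)
open import Data.List.Relation.Unary.All as All using (All; []; _∷_)
open import Data.Nat
open import Data.Nat.Divisibility using (n∣m*n)
open import Data.Nat.DivMod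
open import Data.Nat.ListAction using (sum)
open import Data.Nat.ListAction.Properties using (sum-++)
open import Data.Nat.Properties
open import Data.Nat.Tactic.RingSolver using (solve-∀)
open import Data.Product using (_×_; _,_; proj₁; proj₂)
open import Data.Rational as ℚ using (ℚ) renaming (_≤_ to _≤ℚ_)
import Data.Rational.Properties as ℚP
import Data.Rational.Unnormalised as ℚᵘ
import Data.Rational.Unnormalised.Properties as ℚᵘP
open import Data.Sum using (inj₁; inj₂)
open import Data.Vec using (Vec; []; _∷_)
open import Function using (_∘_)
open import Relation.Binary.Definitions using (tri<; tri≈; tri>)
open import Relation.Binary.PropositionalEquality
open import Relation.Nullary using (Dec; yes; no; does; ¬_; contradiction)
open import Relation.Unary using (Decidable)
open ℚᵘ using () renaming (_≃_ to _≃ᵘ_)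

open import Defs

∑ : ℕ → (ℕ → ℕ) → ℕ
∑ zero    f = 0
∑ (suc n) f = f 0 + ∑ n (f ∘ suc)

∑-cong : ∀ n {f g : ℕ → ℕ} → (∀ i → f i ≡ g i) → ∑ n f ≡ ∑ n g
∑-cong zero    eq = refl
∑-cong (suc n) eq = cong₂ _+_ (eq 0) (∑-cong n (eq ∘ suc))

∑-distrib-+ : ∀ n (f g : ℕ → ℕ) → ∑ n (λ i → f i + g i) ≡ ∑ n f + ∑ n g
∑-distrib-+ zero    f g = refl
∑-distrib-+ (suc n) f g =
  trans (cong (f 0 + g 0 +_) (∑-distrib-+ n (f ∘ suc) (g ∘ suc)))
        (interchange +-commutativeSemigroup (f 0) (g 0) _ _)

∑-zero : ∀ n → ∑ n (λ _ → 0) ≡ 0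
∑-zero zero    = refl
∑-zero (suc n) = ∑-zero n

∑-+ : ∀ m n (f : ℕ → ℕ) → ∑ (m + n) f ≡ ∑ m f + ∑ n (λ i → f (m + i))
∑-+ zero    n f = refl
∑-+ (suc m) n f = trans (cong (f 0 +_) (∑-+ m n (f ∘ suc))) (sym (+-assoc (f 0) _ _))

∑-mixedRadix : ∀ b B (f : ℕ → ℕ) → ∑ b (λ d → ∑ B (λ V → f (d + b * V))) ≡ ∑ (b * B) f
∑-mixedRadix b zero    f = trans (∑-zero b) (cong (λ n → ∑ n f) (sym (*-zeroʳ b)))
∑-mixedRadix b (suc B) f = begin
    ∑ b (λ d → f (d + b * 0) + ∑ B (λ V → f (d + b * suc V)))
  ≡⟨ ∑-cong b (λ d → cong₂ _+_ (cong f (d+b*0≡d d b)) (∑-cong B (λ V → cong f (shift d b V)))) ⟩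
    ∑ b (λ d → f d + ∑ B (λ V → f (b + (d + b * V))))
  ≡⟨ ∑-distrib-+ b f _ ⟩
    ∑ b f + ∑ b (λ d → ∑ B (λ V → f (b + (d + b * V))))
  ≡⟨ cong (∑ b f +_) (∑-mixedRadix b B (f ∘ (b +_))) ⟩
    ∑ b f + ∑ (b * B) (f ∘ (b +_))
  ≡⟨ ∑-+ b (b * B) f ⟨
    ∑ (b + b * B) f
  ≡⟨ cong (λ n → ∑ n f) (*-suc b B) ⟨
    ∑ (b * suc B) f ∎
  where
  open ≡-Reasoning
  d+b*0≡d : ∀ d b → d + b * 0 ≡ d
  d+b*0≡d = solve-∀
  shift : ∀ d b V → d + b * suc V ≡ b + (d + b * V)
  shift = solve-∀

sum-concatMap : ∀ {A B : Set} (f : B → ℕ) (g : A → List B) (xs : List A) →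
  sum (map f (concatMap g xs)) ≡ sum (map (sum ∘ map f ∘ g) xs)
sum-concatMap f g []       = refl
sum-concatMap f g (x ∷ xs) = begin
  sum (map f (g x ++ concatMap g xs))            ≡⟨ cong sum (map-++ f (g x) _) ⟩
  sum (map f (g x) ++ map f (concatMap g xs))    ≡⟨ sum-++ (map f (g x)) _ ⟩
  sum (map f (g x)) + sum (map f (concatMap g xs)) ≡⟨ cong (sum (map f (g x)) +_) (sum-concatMap f g xs) ⟩
  sum (map f (g x)) + sum (map (sum ∘ map f ∘ g) xs) ∎
  where open ≡-Reasoning

sum-tabulate-toℕ : ∀ n (h : ℕ → ℕ) → sum (tabulate {n = n} (h ∘ toℕ)) ≡ ∑ n h
sum-tabulate-toℕ zero    h = refl
sum-tabulate-toℕ (suc n) h = cong (h 0 +_) (sum-tabulate-toℕ n (h ∘ suc))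

value : ∀ {b r} → Vec (Fin b) r → ℕ
value     []       = 0
value {b} (d ∷ ds) = toℕ d + b * value ds

sum-allDigits : ∀ b r (h : ℕ → ℕ) → sum (map (h ∘ value) (allDigits b r)) ≡ ∑ (b ^ r) h
sum-allDigits b zero    h = refl
sum-allDigits b (suc r) h = begin
    sum (map (h ∘ value) (concatMap (λ d → map (d ∷_) (allDigits b r)) (allFin b)))
  ≡⟨ sum-concatMap _ _ (allFin b) ⟩
    sum (map (λ d → sum (map (h ∘ value) (map (d ∷_) (allDigits b r)))) (allFin b))
  ≡⟨ cong sum (map-cong (λ d → trans (cong sum (sym (map-∘ (allDigits b r))))
                                      (sum-allDigits b r (λ V → h (toℕ d + b * V)))) (allFin b)) ⟩
    sum (map (λ d → ∑ (b ^ r) (λ V → h (toℕ d + b * V))) (allFin b))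
  ≡⟨ cong sum (map-tabulate {n = b} (λ i → i) (λ d → ∑ (b ^ r) (λ V → h (toℕ d + b * V)))) ⟩
    sum (tabulate {n = b} (λ d → ∑ (b ^ r) (λ V → h (toℕ d + b * V))))
  ≡⟨ sum-tabulate-toℕ b (λ d → ∑ (b ^ r) (λ V → h (d + b * V))) ⟩
    ∑ b (λ d → ∑ (b ^ r) (λ V → h (d + b * V)))
  ≡⟨ ∑-mixedRadix b (b ^ r) h ⟩
    ∑ (b * b ^ r) h ∎
  where open ≡-Reasoning

χ : ∀ {P : Set} → Dec P → ℕ
χ P? = if does P? then 1 else 0

length-filter≡sum-χ : ∀ {A : Set} {P : A → Set} (P? : Decidable P) (xs : List A) →
  length (filter P? xs) ≡ sum (map (χ ∘ P?) xs)
length-filter≡sum-χ P? []       = refl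
length-filter≡sum-χ P? (x ∷ xs) with does (P? x)
... | true  = cong suc (length-filter≡sum-χ P? xs)
... | false = length-filter≡sum-χ P? xs

χ-yes : ∀ {P : Set} (P? : Dec P) → P → χ P? ≡ 1
χ-yes (yes _) _ = refl
χ-yes (no ¬p) p = contradiction p ¬p

χ-no : ∀ {P : Set} (P? : Dec P) → ¬ P → χ P? ≡ 0
χ-no (yes p) ¬p = contradiction p ¬p
χ-no (no _)  _  = refl

χ-cong : ∀ {P Q : Set} (P? : Dec P) (Q? : Dec Q) → (P → Q) → (Q → P) → χ P? ≡ χ Q?
χ-cong (yes _) (yes _) _ _ = refl
χ-cong (no _)  (no _)  _ _ = refl
χ-cong (yes p) (no ¬q) f _ = contradiction (f p) ¬q
χ-cong (no ¬p) (yes q) _ g = contradiction (g q) ¬p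

χ-<-suc : ∀ m n → χ (m <? suc n) ≡ χ (m <? n) + χ (m ≟ n)
χ-<-suc m n with <-cmp m n
... | tri< m<n m≢n _
  rewrite χ-yes (m <? suc n) (m<n⇒m<1+n m<n) | χ-yes (m <? n) m<n | χ-no (m ≟ n) m≢n = refl
... | tri≈ m≮n m≡n _
  rewrite χ-yes (m <? suc n) (s≤s (≤-reflexive m≡n)) | χ-no (m <? n) m≮n | χ-yes (m ≟ n) m≡n = refl
... | tri> m≮n m≢n n<m
  rewrite χ-no (m <? suc n) (<⇒≱ n<m ∘ s≤s⁻¹) | χ-no (m <? n) m≮n | χ-no (m ≟ n) m≢n = refl

[m+n*o]/o≡m/o+n : ∀ m n o .{{_ : NonZero o}} → (m + n * o) / o ≡ m / o + n
[m+n*o]/o≡m/o+n m n o = trans (+-distrib-/-∣ʳ m (n∣m*n n)) (cong (m / o +_) (m*n/n≡m n o))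

module _ {b : ℕ} (hb : 2 ≤ b) (k : ℕ) where

  private instance
    b≢0 : NonZero b
    b≢0 = nz₂ hb

  _/b^_ : ℕ → ℕ → ℕ
  m /b^ r = _/_ m (b ^ r) {{m^n≢0 b r}}

  carryFrom≡⌊/⌋ : ∀ {r} κ (ds : Vec (Fin b) r) → carryFrom hb k κ ds ≡ (κ + k * value ds) /b^ r
  carryFrom≡⌊/⌋ κ [] rewrite *-zeroʳ k | +-identityʳ κ = sym (n/1≡n κ)
  carryFrom≡⌊/⌋ {suc r} κ (d ∷ ds) = begin
      carryFrom hb k ((κ + k * toℕ d) / b) ds
    ≡⟨ carryFrom≡⌊/⌋ _ ds ⟩
      ((κ + k * toℕ d) / b + k * value ds) / b ^ r
    ≡⟨ /-congˡ ([m+n*o]/o≡m/o+n (κ + k * toℕ d) (k * value ds) b) ⟨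
      ((κ + k * toℕ d + k * value ds * b) / b) / b ^ r
    ≡⟨ m/n/o≡m/[n*o] _ b (b ^ r) ⟩
      (κ + k * toℕ d + k * value ds * b) / (b * b ^ r)
    ≡⟨ /-congˡ (digit-step κ k (toℕ d) (value ds) b) ⟩
      (κ + k * (toℕ d + b * value ds)) / (b * b ^ r) ∎
    where
    open ≡-Reasoning
    instance
      b^r≢0 : NonZero (b ^ r)
      b^r≢0 = m^n≢0 b r
      b^1+r≢0 : NonZero (b ^ suc r)
      b^1+r≢0 = m^n≢0 b (suc r)
    digit-step : ∀ κ k d V b → κ + k * d + k * V * b ≡ κ + k * (d + b * V)
    digit-step = solve-∀

m+n<o⇒n<o∸m : ∀ m {n o} → m + n < o → n < o ∸ m
m+n<o⇒n<o∸m m {n} {o} lt = m+n≤o⇒m≤o∸n (suc n) (subst (_≤ o) (cong suc (+-comm m n)) lt)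

n<o∸m⇒m+n<o : ∀ m {n o} → n < o ∸ m → m + n < o
n<o∸m⇒m+n<o m {n} {o} lt with m ≤? o
... | yes m≤o = subst (_≤ o) (cong suc (+-comm n m)) (m≤o∸n⇒m+n≤o (suc n) m≤o lt)
... | no  m≰o = contradiction (subst (n <_) (m≤n⇒m∸n≡0 (<⇒≤ (≰⇒> m≰o))) lt) λ ()

module MultiplesBelow (k : ℕ) where

  multiplesBelow : ℕ → ℕ → ℕ
  multiplesBelow n x = ∑ n (λ N → χ (k * N <? x))

  multiplesBelow-zero : ∀ n → multiplesBelow n 0 ≡ 0
  multiplesBelow-zero n = trans (∑-cong n (λ N → χ-no (k * N <? 0) λ ())) (∑-zero n)

  multiplesBelow-suc : ∀ n x → multiplesBelow (suc n) (suc x) ≡ suc (multiplesBelow n (suc x ∸ k))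
  multiplesBelow-suc n x = cong₂ _+_ (χ-yes (k * 0 <? suc x) (subst (_< suc x) (sym (*-zeroʳ k)) z<s))
    (∑-cong n (λ N → χ-cong (k * suc N <? suc x) (k * N <? suc x ∸ k)
      (λ lt → m+n<o⇒n<o∸m k (subst (_< suc x) (*-suc k N) lt))
      (λ lt → subst (_< suc x) (sym (*-suc k N)) (n<o∸m⇒m+n<o k lt))))

  multiplesBelow-bounds : 1 ≤ k → ∀ n x → x ≤ k * n →
    x ≤ k * multiplesBelow n x × k * multiplesBelow n x < x + k
  multiplesBelow-bounds hk n zero _ rewrite multiplesBelow-zero n | *-zeroʳ k = z≤n , hk
  multiplesBelow-bounds hk zero (suc x) hx = contradiction (subst (suc x ≤_) (*-zeroʳ k) hx) λ ()
  multiplesBelow-bounds hk (suc n) (suc x) hx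
    rewrite multiplesBelow-suc n x | *-suc k (multiplesBelow n (suc x ∸ k)) =
      ≤-trans (m≤n+m∸n (suc x) k) (+-monoʳ-≤ k lower)
    , subst (_< suc x + k) (+-comm _ k) (+-monoˡ-< k previous<x)
    where
    y : ℕ
    y = suc x ∸ k
    H : ℕ
    H = multiplesBelow n y
    bounds : y ≤ k * H × k * H < y + k
    bounds = multiplesBelow-bounds hk n y (m≤n+o⇒m∸n≤o (suc x) k (subst (suc x ≤_) (*-suc k n) hx))
    lower : y ≤ k * H
    lower = proj₁ bounds
    upper : k * H < y + k
    upper = proj₂ bounds
    previous<x : k * H < suc x
    previous<x with k ≤? suc x
    ... | yes k≤x = subst (k * H <_) (m∸n+n≡m k≤x) upper
    ... | no  k≰x rewrite m≤n⇒m∸n≡0 (<⇒≤ (≰⇒> k≰x)) | multiplesBelow-zero n | *-zeroʳ k = z<s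

m/o<n⇒m<n*o : ∀ {m n o} .{{_ : NonZero o}} → m / o < n → m < n * o
m/o<n⇒m<n*o {m} {n} {o} lt = begin-strict
  m                   ≡⟨ m≡m%n+[m/n]*n m o ⟩
  m % o + (m / o) * o <⟨ +-monoˡ-< ((m / o) * o) (m%n<n m o) ⟩
  suc (m / o) * o     ≤⟨ *-monoˡ-≤ o lt ⟩
  n * o               ∎
  where open ≤-Reasoning

m<n+o∧n<m+o⇒∣m⊖n∣≤o : ∀ {m n o} → m < n + o → n < m + o → ℤ.∣ m ⊖ n ∣ ≤ o
m<n+o∧n<m+o⇒∣m⊖n∣≤o {m} {n} {o} m<n+o n<m+o with ≤-total m n
... | inj₁ m≤n = subst (_≤ o) (sym (ℤP.∣⊖∣-≤ m≤n)) (m≤n+o⇒m∸n≤o n m (<⇒≤ n<m+o))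
... | inj₂ n≤m = subst (_≤ o) (sym (trans (ℤP.∣m⊖n∣≡∣n⊖m∣ m n) (ℤP.∣⊖∣-≤ n≤m))) (m≤n+o⇒m∸n≤o m n (<⇒≤ m<n+o))

∣⊖∣≤-of-approximations : ∀ {x y a c d} → x ≤ a → a < x + d → y + x ≤ a + c → a + c < y + x + d →
  ℤ.∣ c ⊖ y ∣ ≤ d
∣⊖∣≤-of-approximations {x} {y} {a} {c} {d} x≤a a<x+d y+x≤a+c a+c<y+x+d =
  m<n+o∧n<m+o⇒∣m⊖n∣≤o (+-cancelˡ-< x c (y + d) c<y+d) (+-cancelˡ-< x y (c + d) y<c+d)
  where
  open ≤-Reasoning
  c<y+d : x + c < x + (y + d)
  c<y+d = begin-strict
    x + c       ≤⟨ +-monoˡ-≤ c x≤a ⟩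
    a + c       <⟨ a+c<y+x+d ⟩
    y + x + d   ≡⟨ rearrange y x d ⟩
    x + (y + d) ∎
    where
    rearrange : ∀ y x d → y + x + d ≡ x + (y + d)
    rearrange = solve-∀
  y<c+d : x + y < x + (c + d)
  y<c+d = begin-strict
    x + y       ≡⟨ +-comm x y ⟩
    y + x       ≤⟨ y+x≤a+c ⟩
    a + c       <⟨ +-monoˡ-< c a<x+d ⟩
    x + d + c   ≡⟨ rearrange x d c ⟩
    x + (c + d) ∎
    where
    rearrange : ∀ x d c → x + d + c ≡ x + (c + d)
    rearrange = solve-∀

module Levels (k B : ℕ) .{{_ : NonZero B}} where
  open MultiplesBelow k

  level : ℕ → ℕ
  level N = k * N / B

  levelCount : ℕ → ℕ
  levelCount j = ∑ B (λ N → χ (level N ≟ j))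

  levelsBelow : ℕ → ℕ
  levelsBelow i = ∑ B (λ N → χ (level N <? i))

  levelsBelow-suc : ∀ j → levelsBelow (suc j) ≡ levelsBelow j + levelCount j
  levelsBelow-suc j = trans (∑-cong B (λ N → χ-<-suc (level N) j)) (∑-distrib-+ B _ _)

  levelsBelow≡multiplesBelow : ∀ i → levelsBelow i ≡ multiplesBelow B (i * B)
  levelsBelow≡multiplesBelow i = ∑-cong B (λ N →
    χ-cong (level N <? i) (k * N <? i * B) m/o<n⇒m<n*o m<n*o⇒m/o<n)

  levelsBelow-bounds : 1 ≤ k → ∀ i → i ≤ k → i * B ≤ k * levelsBelow i × k * levelsBelow i < i * B + k
  levelsBelow-bounds hk i i≤k rewrite levelsBelow≡multiplesBelow i =
    multiplesBelow-bounds hk B (i * B) (*-monoˡ-≤ B i≤k)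

  ∣k*levelCount⊖B∣≤k : 1 ≤ k → ∀ j → j < k → ℤ.∣ k * levelCount j ⊖ B ∣ ≤ k
  ∣k*levelCount⊖B∣≤k hk j j<k = ∣⊖∣≤-of-approximations
    (proj₁ (levelsBelow-bounds hk j (<⇒≤ j<k))) (proj₂ (levelsBelow-bounds hk j (<⇒≤ j<k)))
    (subst (suc j * B ≤_) k*levelsBelow-suc (proj₁ (levelsBelow-bounds hk (suc j) j<k)))
    (subst (_< suc j * B + k) k*levelsBelow-suc (proj₂ (levelsBelow-bounds hk (suc j) j<k)))
    where
    k*levelsBelow-suc : k * levelsBelow (suc j) ≡ k * levelsBelow j + k * levelCount j
    k*levelsBelow-suc = trans (cong (k *_) (levelsBelow-suc j)) (*-distribˡ-+ k _ _)

toℚᵘ-/ : ∀ (n : ℤ) d .{{_ : NonZero d}} → ℚ.toℚᵘ (n ℚ./ d) ≃ᵘ (n ℚᵘ./ d)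
toℚᵘ-/ n (suc d) = ℚP.toℚᵘ-fromℚᵘ (ℚᵘ.mkℚᵘ n d)

1/d+n/d≃[1+n]/d : ∀ n d .{{_ : NonZero d}} → (ℤ.+ 1) ℚᵘ./ d ℚᵘ.+ (ℤ.+ n) ℚᵘ./ d ≃ᵘ (ℤ.+ suc n) ℚᵘ./ d
1/d+n/d≃[1+n]/d n (suc d) = ℚᵘ.*≡* (cross-multiplied (ℤ.+ n) (ℤ.+ suc d))
  where
  cross-multiplied : ∀ (n d : ℤ) → (ℤ.1ℤ ℤ.* d ℤ.+ n ℤ.* d) ℤ.* d ≡ (ℤ.1ℤ ℤ.+ n) ℤ.* (d ℤ.* d)
  cross-multiplied = ℤ-solve-∀

∣c/d-1/e∣≤1/dᵘ : ∀ c d e .{{_ : NonZero d}} .{{_ : NonZero e}} → ℤ.∣ e * c ⊖ d ∣ ≤ e →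
  ℚᵘ.∣ (ℤ.+ c) ℚᵘ./ d ℚᵘ.- (ℤ.+ 1) ℚᵘ./ e ∣ ℚᵘ.≤ (ℤ.+ 1) ℚᵘ./ d
∣c/d-1/e∣≤1/dᵘ c d@(suc _) e@(suc _) ∣ec⊖d∣≤e =
  ℚᵘ.*≤* (subst₂ ℤ._≤_ (ℤP.pos-* n d) (sym (ℤP.*-identityˡ (ℤ.+ (d * e))))
    (ℤ.+≤+ (subst (n * d ≤_) (*-comm e d) (*-monoˡ-≤ d (subst (_≤ e) (sym numerator) ∣ec⊖d∣≤e)))))
  where
  open ≡-Reasoning
  n : ℕ
  n = ℤ.∣ (ℤ.+ c) ℤ.* (ℤ.+ e) ℤ.+ (ℤ.- (ℤ.+ 1)) ℤ.* (ℤ.+ d) ∣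
  numerator : n ≡ ℤ.∣ e * c ⊖ d ∣
  numerator = cong ℤ.∣_∣ (begin
    (ℤ.+ c) ℤ.* (ℤ.+ e) ℤ.+ (ℤ.- (ℤ.+ 1)) ℤ.* (ℤ.+ d) ≡⟨ cong₂ ℤ._+_ (sym (ℤP.pos-* c e)) (ℤP.-1*i≡-i (ℤ.+ d)) ⟩
    ℤ.+ (c * e) ℤ.- ℤ.+ d                               ≡⟨ ℤP.m-n≡m⊖n (c * e) d ⟩
    c * e ⊖ d                                           ≡⟨ cong (_⊖ d) (*-comm c e) ⟩
    e * c ⊖ d                                           ∎)

∣c/d-1/e∣≤1/d : ∀ c d e .{{_ : NonZero d}} .{{_ : NonZero e}} → ℤ.∣ e * c ⊖ d ∣ ≤ e →
  ℚ.∣ (ℤ.+ c) ℚ./ d ℚ.- (ℤ.+ 1) ℚ./ e ∣ ℚ.≤ (ℤ.+ 1) ℚ./ d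
∣c/d-1/e∣≤1/d c d e ∣ec⊖d∣≤e = ℚP.toℚᵘ-cancel-≤ (begin
    ℚ.toℚᵘ ℚ.∣ x ℚ.- y ∣
  ≃⟨ ℚP.toℚᵘ-homo-∣-∣ (x ℚ.- y) ⟩
    ℚᵘ.∣ ℚ.toℚᵘ (x ℚ.- y) ∣
  ≃⟨ ℚᵘP.∣-∣-cong (ℚᵘP.≃-trans (ℚP.toℚᵘ-homo-+ x (ℚ.- y))
       (ℚᵘP.+-cong (toℚᵘ-/ (ℤ.+ c) d) (ℚᵘP.≃-trans (ℚP.toℚᵘ-homo‿- y) (ℚᵘP.-‿cong (toℚᵘ-/ (ℤ.+ 1) e))))) ⟩
    ℚᵘ.∣ (ℤ.+ c) ℚᵘ./ d ℚᵘ.- (ℤ.+ 1) ℚᵘ./ e ∣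
  ≤⟨ ∣c/d-1/e∣≤1/dᵘ c d e ∣ec⊖d∣≤e ⟩
    (ℤ.+ 1) ℚᵘ./ d
  ≃⟨ toℚᵘ-/ (ℤ.+ 1) d ⟨
    ℚ.toℚᵘ ((ℤ.+ 1) ℚ./ d) ∎)
  where
  open ℚᵘP.≤-Reasoning
  x y : ℚ
  x = (ℤ.+ c) ℚ./ d
  y = (ℤ.+ 1) ℚ./ e

sumℚ-mono-≤ : ∀ (f g : ℕ → ℚ) xs → All (λ j → f j ℚ.≤ g j) xs → sumℚ (map f xs) ℚ.≤ sumℚ (map g xs)
sumℚ-mono-≤ f g []       []         = ℚP.≤-refl
sumℚ-mono-≤ f g (x ∷ xs) (fx≤gx ∷ p) = ℚP.+-mono-≤ fx≤gx (sumℚ-mono-≤ f g xs p)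

sumℚ-const-1/d : ∀ d .{{_ : NonZero d}} (xs : List ℕ) →
  sumℚ (map (λ _ → (ℤ.+ 1) ℚ./ d) xs) ≡ (ℤ.+ length xs) ℚ./ d
sumℚ-const-1/d d xs = ℚP.toℚᵘ-injective (ℚᵘP.≃-trans (unnormalised d xs) (ℚᵘP.≃-sym (toℚᵘ-/ (ℤ.+ length xs) d)))
  where
  unnormalised : ∀ d .{{_ : NonZero d}} xs → ℚ.toℚᵘ (sumℚ (map (λ _ → (ℤ.+ 1) ℚ./ d) xs)) ≃ᵘ (ℤ.+ length xs) ℚᵘ./ d
  unnormalised (suc _) []       = ℚᵘ.*≡* refl
  unnormalised d       (x ∷ xs) = ℚᵘP.≃-trans (ℚP.toℚᵘ-homo-+ ((ℤ.+ 1) ℚ./ d) _)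
    (ℚᵘP.≃-trans (ℚᵘP.+-cong (toℚᵘ-/ (ℤ.+ 1) d) (unnormalised d xs)) (1/d+n/d≃[1+n]/d (length xs) d))

carryCount≡levelCount : ∀ {b} (hb : 2 ≤ b) k r j →
  length (filter (λ ds → carry hb k ds ≟ j) (allDigits b r))
    ≡ Levels.levelCount k (b ^ r) {{m^n≢0 b r {{nz₂ hb}}}} j
carryCount≡levelCount {b} hb k r j = begin
    length (filter (λ ds → carry hb k ds ≟ j) (allDigits b r))
  ≡⟨ length-filter≡sum-χ (λ ds → carry hb k ds ≟ j) (allDigits b r) ⟩
    sum (map (λ ds → χ (carry hb k ds ≟ j)) (allDigits b r))
  ≡⟨ cong sum (map-cong (λ ds → cong (λ κ → χ (κ ≟ j)) (carryFrom≡⌊/⌋ hb k 0 ds)) (allDigits b r)) ⟩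
    sum (map (λ ds → χ (level (value ds) ≟ j)) (allDigits b r))
  ≡⟨ sum-allDigits b r (λ N → χ (level N ≟ j)) ⟩
    levelCount j ∎
  where
  open ≡-Reasoning
  open Levels k (b ^ r) {{m^n≢0 b r {{nz₂ hb}}}}

proposition5p1 : (b k : ℕ) (hb : 2 ≤ b) (hk : 1 ≤ k) (r : ℕ) →
    tvDist hb hk r ≤ℚ bound hb k r
proposition5p1 b k hb hk r = ℚP.*-monoˡ-≤-nonNeg ℚ.½ (begin
    sumℚ (map (λ j → ℚ.∣ K₀ hb k r j ℚ.- π hk j ∣) (upTo k))
  ≤⟨ sumℚ-mono-≤ _ _ (upTo k) (All.tabulate (term-bound ∘ ∈-upTo⁻)) ⟩
    sumℚ (map (λ _ → (ℤ.+ 1) ℚ./ b ^ r) (upTo k))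
  ≡⟨ sumℚ-const-1/d (b ^ r) (upTo k) ⟩
    (ℤ.+ length (upTo k)) ℚ./ b ^ r
  ≡⟨ cong (λ n → (ℤ.+ n) ℚ./ b ^ r) (length-upTo k) ⟩
    (ℤ.+ k) ℚ./ b ^ r ∎)
  where
  open ℚP.≤-Reasoning
  instance
    b^r≢0 : NonZero (b ^ r)
    b^r≢0 = m^n≢0 b r {{nz₂ hb}}
    k≢0 : NonZero k
    k≢0 = nz₁ hk
  term-bound : ∀ {j} → j < k → ℚ.∣ K₀ hb k r j ℚ.- π hk j ∣ ℚ.≤ (ℤ.+ 1) ℚ./ b ^ r
  term-bound {j} j<k = ∣c/d-1/e∣≤1/d _ (b ^ r) k
    (subst (λ c → ℤ.∣ k * c ⊖ b ^ r ∣ ≤ k) (sym (carryCount≡levelCount hb k r j))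
      (Levels.∣k*levelCount⊖B∣≤k k (b ^ r) hk j j<k))
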